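{- A weak AMD code with $m$ sources over a group $\mathcal{G}$ of order $n$, with total number of valid encodings $a$, satisfies $\hat\epsilon=\frac{a(m-1)}{m(n-1)}$ (i.e. is R-optimal) if and only if $\epsilon_\Delta=\frac{a(m-1)}{m(n-1)}$ for every $\Delta\in\mathcal{G}\setminus\{0\}$.
   Context: Let $\mathcal{G}$ be a finite additive abelian group of order $n\ge 2$ and $\mathcal{S}$ a set of $m$ sources. An AMD code consists of pairwise disjoint nonempty subsets $A(s)\subseteq\mathcal{G}$ ($s\in\mathcal{S}$) of valid encodings and a (possibly randomized) public encoding function $E$ mapping each source $s$ to some $g\in A(s)$ according to a probability distribution $\Pr[E(s)=g]$ on $A(s)$. Write $a_s=|A(s)|$ and $a=\sum_s a_s$. Weak security game: the adversary, knowing the code, chooses $\Delta\in\mathcal{G}\setminus\{0\}$ according to a (possibly randomized) strategy $\sigma$; then a source $s$ is chosen uniformly at random from $\mathcal{S}$ and encoded as $g=E(s)$; the adversary wins iff $g+\Delta\in A(s')$ for some $s'\ne s$. $\epsilon_\sigma$ is the winning probability of $\sigma$ and $\hat\epsilon=\max_\sigma\epsilon_\sigma$. For a fixed $\Delta\ne 0$, $\epsilon_\Delta$ is the winning probability of the strategy that always chooses $\Delta$.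
   Formalization: The encoding probabilities $\Pr[E(s)=g]$ of each code and the probabilities of the adversary's randomized strategies $\sigma$ take rational values. -}

module Defs where

open import Data.Nat as ℕ using (ℕ; zero; suc; _∸_)
open import Data.Integer using (+_)
open import Data.Fin using (Fin; zero; suc)
import Data.Fin as F
open import Data.Bool using (Bool; true; false; not; _∧_; _∨_; if_then_else_)
open import Data.Rational using (ℚ; 0ℚ; 1ℚ; _+_; _*_; _/_; _≤_)
open import Data.Product using (Σ; ∃; _×_)
open import Relation.Nullary using (does; ¬_)
open import Relation.Binary.PropositionalEquality using (_≡_)
open import Algebra.Structures using (IsAbelianGroup)

-- A finite abelian group of order n, realised on the carrier Fin n
-- (every finite abelian group of order n is isomorphic to one of these).
record FinAbGroup (n : ℕ) : Set where
  field
    _⊕_ : Fin n → Fin n → Fin n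
    𝟘 : Fin n
    ⊖_ : Fin n → Fin n
    isAbelianGroup : IsAbelianGroup _≡_ _⊕_ 𝟘 ⊖_

sumFin : (k : ℕ) → (Fin k → ℚ) → ℚ
sumFin zero f = 0ℚ
sumFin (suc k) f = f zero + sumFin k (λ i → f (suc i))

countFin : (k : ℕ) → (Fin k → Bool) → ℕ
countFin zero f = 0
countFin (suc k) f = (if f zero then 1 else 0) ℕ.+ countFin k (λ i → f (suc i))

anyFin : (k : ℕ) → (Fin k → Bool) → Bool
anyFin zero f = false
anyFin (suc k) f = f zero ∨ anyFin k (λ i → f (suc i))

ind : Bool → ℚ
ind true = 1ℚ
ind false = 0ℚ

-- An AMD code with m sources (Fin m) over G.
-- A s g = true  iff  g ∈ A(s);  P s g = Pr[E(s) = g].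
record AMDCode {n : ℕ} (G : FinAbGroup n) (m : ℕ) : Set where
  field
    A : Fin m → Fin n → Bool
    disjoint : ∀ s s' g → A s g ≡ true → A s' g ≡ true → s ≡ s'
    nonempty : ∀ s → ∃ λ g → A s g ≡ true
    P : Fin m → Fin n → ℚ
    P-nonneg : ∀ s g → 0ℚ ≤ P s g
    P-support : ∀ s g → A s g ≡ false → P s g ≡ 0ℚ
    P-sum : ∀ s → sumFin n (P s) ≡ 1ℚ

totalEnc : ∀ {n m} {G : FinAbGroup n} → AMDCode G m → ℕ
totalEnc {n} {m} C = go m (AMDCode.A C)
  where
  go : (k : ℕ) → (Fin k → Fin n → Bool) → ℕ
  go zero _ = 0
  go (suc k) B = countFin n (B zero) ℕ.+ go k (λ i → B (suc i))

-- 1/m (junk value 0 for m = 0, excluded by hypothesis)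
invℕ : ℕ → ℚ
invℕ zero = 0ℚ
invℕ (suc k) = (+ 1) / suc k

-- a(m-1) / (m(n-1)) (junk value 0 when m = 0 or n < 2, excluded by hypothesis)
rOpt : (m n a : ℕ) → ℚ
rOpt (suc m) (suc (suc n)) a = (+ (a ℕ.* m)) / (suc m ℕ.* suc n)
rOpt _ _ _ = 0ℚ

module _ {n m : ℕ} (G : FinAbGroup n) (C : AMDCode G m) where
  open FinAbGroup G
  open AMDCode C

  wins : Fin m → Fin n → Fin n → Bool
  wins s g Δ = anyFin m (λ s' → not (does (s F.≟ s')) ∧ A s' (g ⊕ Δ))

  epsΔ : Fin n → ℚ
  epsΔ Δ = invℕ m * sumFin m (λ s → sumFin n (λ g → P s g * ind (wins s g Δ)))

record Strategy {n : ℕ} (G : FinAbGroup n) : Set where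
  field
    σ : Fin n → ℚ
    σ-nonneg : ∀ Δ → 0ℚ ≤ σ Δ
    σ-zero : σ (FinAbGroup.𝟘 G) ≡ 0ℚ
    σ-sum : sumFin n σ ≡ 1ℚ

-- ε_σ = Σ_Δ σ(Δ) ε_Δ  (adversary's coins independent of the encoding)
epsσ : ∀ {n m} (G : FinAbGroup n) (C : AMDCode G m) → Strategy G → ℚ
epsσ {n} G C S = sumFin n (λ Δ → Strategy.σ S Δ * epsΔ G C Δ)

EpsHatIs : ∀ {n m} (G : FinAbGroup n) (C : AMDCode G m) → ℚ → Set
EpsHatIs G C c = (∀ S → epsσ G C S ≤ c) × (∃ λ S → epsσ G C S ≡ c)

-- For every code, ε_𝟘 = 0, and summing ε_Δ over all shifts Δ counts, for each
-- source s and encoding g, the shifts landing in some A(t) with t ≠ s; since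
-- translation by g permutes the group there are exactly a − a_s of them, so
-- Σ_Δ ε_Δ = (1/m) Σ_s (a − a_s) = a(m−1)/m = (n−1)·R with R = a(m−1)/(m(n−1)).
-- A strategy wins with the σ-average of the ε_Δ over Δ ≠ 0, and the point
-- strategies realise each ε_Δ.  So ε̂ = R means every ε_Δ (Δ ≠ 0) is at most R,
-- and as these n−1 values sum to (n−1)·R they all equal R; conversely, if all
-- of them equal R then every strategy wins with probability exactly R.
module Submission where

open import Defs
open import Algebra.Bundles using (CommutativeRing; Group)
open import Algebra.Structures using (IsAbelianGroup)
open import Data.Bool using (Bool; true; false; not; _∧_)
open import Data.Bool.Properties using (∧-conicalʳ)
open import Data.Fin using (Fin; zero; suc; _≟_; punchIn)
open import Data.Fin.Permutation using (Permutation; permutation)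
open import Data.Fin.Properties using (suc-injective; punchInᵢ≢i)
import Data.Integer as ℤ
import Data.Integer.Properties as ℤ
open import Data.Nat as ℕ using (ℕ; _≤_; zero; suc; s≤s; z≤n)
import Data.Nat.Properties as ℕ
open import Data.Product using (_,_)
open import Data.Rational as ℚ using (ℚ; 0ℚ; 1ℚ; _+_; _*_; _/_; toℚᵘ)
import Data.Rational.Properties as ℚ
open import Data.Rational.Solver using (module +-*-Solver)
open import Data.Rational.Unnormalised as ℚᵘ using (mkℚᵘ; *≡*)
import Data.Rational.Unnormalised.Properties as ℚᵘ
open import Function.Base using (_∘_)
open import Function.Bundles using (_⇔_; mk⇔)
open import Level using (0ℓ)
open import Relation.Binary.PropositionalEquality
  using (_≡_; _≢_; refl; sym; trans; cong; cong₂; subst₂; module ≡-Reasoning)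
open import Relation.Nullary using (¬_; yes; no; contradiction)
open import Relation.Nullary.Decidable using (does; dec-true; dec-false)

open import Algebra.Properties.Semiring.Sum (CommutativeRing.semiring ℚ.+-*-commutativeRing)
  using (sum; sum-syntax; sum-cong-≗; sum-replicate; sum-replicate-zero; sum-remove;
         ∑-comm; ∑-permute; *-distribˡ-sum; *-distribʳ-sum)
open import Algebra.Properties.Semiring.Mult (CommutativeRing.semiring ℚ.+-*-commutativeRing)
  using (_×_; ×-homo-1; ×-homo-+; ×1-homo-*)

open ≡-Reasoning

sumFin≡sum : ∀ k (f : Fin k → ℚ) → sumFin k f ≡ sum f
sumFin≡sum zero    f = refl
sumFin≡sum (suc k) f = cong (f zero +_) (sumFin≡sum k (f ∘ suc))

∑-zero : ∀ {k} {f : Fin k → ℚ} → (∀ i → f i ≡ 0ℚ) → sum f ≡ 0ℚ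
∑-zero {k} f≡0 = trans (sum-cong-≗ f≡0) (sum-replicate-zero k)

∑-single : ∀ {k} (f : Fin k → ℚ) j → (∀ i → i ≢ j → f i ≡ 0ℚ) → sum f ≡ f j
∑-single {suc k} f j vanish = begin
  sum f                            ≡⟨ sum-remove {i = j} f ⟩
  f j + ∑[ i < k ] f (punchIn j i) ≡⟨ cong (f j +_) (∑-zero (vanish _ ∘ punchInᵢ≢i j)) ⟩
  f j + 0ℚ                         ≡⟨ ℚ.+-identityʳ (f j) ⟩
  f j                              ∎

∑-mono-≤ : ∀ {k} {f g : Fin k → ℚ} → (∀ i → f i ℚ.≤ g i) → sum f ℚ.≤ sum g
∑-mono-≤ {zero}  _   = ℚ.≤-refl
∑-mono-≤ {suc k} f≤g = ℚ.+-mono-≤ (f≤g zero) (∑-mono-≤ (f≤g ∘ suc))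

∑-≤-≡⇒≡ : ∀ {k} {f g : Fin k → ℚ} → (∀ i → f i ℚ.≤ g i) → sum f ≡ sum g → ∀ i → f i ≡ g i
∑-≤-≡⇒≡ {suc k} {f} {g} f≤g ∑f≡∑g i = ℚ.≤-antisym (f≤g i) (ℚ.≮⇒≥ fᵢ≮gᵢ)
  where
  fᵢ≮gᵢ : ¬ f i ℚ.< g i
  fᵢ≮gᵢ fᵢ<gᵢ = ℚ.<-irrefl ∑f≡∑g
    (subst₂ ℚ._<_ (sym (sum-remove {i = i} f)) (sym (sum-remove {i = i} g))
      (ℚ.+-mono-<-≤ fᵢ<gᵢ (∑-mono-≤ (f≤g ∘ punchIn i))))

_≡ᵇ_ _≢ᵇ_ : ∀ {k} → Fin k → Fin k → Bool
i ≡ᵇ j = does (i ≟ j)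
i ≢ᵇ j = not (i ≡ᵇ j)

ind-nonneg : ∀ b → 0ℚ ℚ.≤ ind b
ind-nonneg true  = ℚ.nonNegative⁻¹ 1ℚ
ind-nonneg false = ℚ.≤-refl

ind-∧ : ∀ b c → ind (b ∧ c) ≡ ind b * ind c
ind-∧ true  c = sym (ℚ.*-identityˡ (ind c))
ind-∧ false c = sym (ℚ.*-zeroˡ (ind c))

ind-≡ᵇ-refl : ∀ {k} (i : Fin k) → ind (i ≡ᵇ i) ≡ 1ℚ
ind-≡ᵇ-refl i = cong ind (dec-true (i ≟ i) refl)

ind-≡ᵇ-≢ : ∀ {k} {i j : Fin k} → i ≢ j → ind (i ≡ᵇ j) ≡ 0ℚ
ind-≡ᵇ-≢ {i = i} {j} i≢j = cong ind (dec-false (i ≟ j) i≢j)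

ind-≢ᵇ-refl : ∀ {k} (i : Fin k) → ind (i ≢ᵇ i) ≡ 0ℚ
ind-≢ᵇ-refl i = cong (ind ∘ not) (dec-true (i ≟ i) refl)

ind-≢ᵇ-≢ : ∀ {k} {i j : Fin k} → i ≢ j → ind (i ≢ᵇ j) ≡ 1ℚ
ind-≢ᵇ-≢ {i = i} {j} i≢j = cong (ind ∘ not) (dec-false (i ≟ j) i≢j)

∑-δ : ∀ {k} (f : Fin k → ℚ) j → ∑[ i < k ] (ind (i ≡ᵇ j) * f i) ≡ f j
∑-δ f j = begin
  ∑[ i < _ ] (ind (i ≡ᵇ j) * f i) ≡⟨ ∑-single _ j off-j-vanishes ⟩
  ind (j ≡ᵇ j) * f j              ≡⟨ cong (_* f j) (ind-≡ᵇ-refl j) ⟩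
  1ℚ * f j                        ≡⟨ ℚ.*-identityˡ (f j) ⟩
  f j                             ∎
  where
  off-j-vanishes : ∀ i → i ≢ j → ind (i ≡ᵇ j) * f i ≡ 0ℚ
  off-j-vanishes i i≢j = trans (cong (_* f i) (ind-≡ᵇ-≢ i≢j)) (ℚ.*-zeroˡ (f i))

∑-≢ᵇ : ∀ {k} (j : Fin (suc k)) → ∑[ i < suc k ] ind (i ≢ᵇ j) ≡ k × 1ℚ
∑-≢ᵇ {k} j = begin
  ∑[ i < suc k ] ind (i ≢ᵇ j)
    ≡⟨ sum-remove {i = j} (λ i → ind (i ≢ᵇ j)) ⟩
  ind (j ≢ᵇ j) + ∑[ i < k ] ind (punchIn j i ≢ᵇ j)
    ≡⟨ cong₂ _+_ (ind-≢ᵇ-refl j) (sum-cong-≗ (ind-≢ᵇ-≢ ∘ punchInᵢ≢i j)) ⟩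
  0ℚ + ∑[ i < k ] 1ℚ
    ≡⟨ ℚ.+-identityˡ _ ⟩
  ∑[ i < k ] 1ℚ
    ≡⟨ sum-replicate k ⟩
  k × 1ℚ
    ∎

∑-off-diagonal : ∀ {k} (x : Fin (suc k) → ℚ) →
                 ∑[ s < suc k ] ∑[ t < suc k ] (ind (s ≢ᵇ t) * x t) ≡ k × 1ℚ * sum x
∑-off-diagonal {k} x = begin
  ∑[ s < suc k ] ∑[ t < suc k ] (ind (s ≢ᵇ t) * x t)
    ≡⟨ ∑-comm (λ s t → ind (s ≢ᵇ t) * x t) ⟩
  ∑[ t < suc k ] ∑[ s < suc k ] (ind (s ≢ᵇ t) * x t)
    ≡⟨ sum-cong-≗ (λ t → sym (*-distribʳ-sum (x t) (λ s → ind (s ≢ᵇ t)))) ⟩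
  ∑[ t < suc k ] ((∑[ s < suc k ] ind (s ≢ᵇ t)) * x t)
    ≡⟨ sum-cong-≗ (λ t → cong (_* x t) (∑-≢ᵇ t)) ⟩
  ∑[ t < suc k ] (k × 1ℚ * x t)
    ≡⟨ sym (*-distribˡ-sum (k × 1ℚ) x) ⟩
  k × 1ℚ * sum x
    ∎

ind-anyFin : ∀ k (b : Fin k → Bool) → (∀ i j → b i ≡ true → b j ≡ true → i ≡ j) →
             ind (anyFin k b) ≡ ∑[ i < k ] ind (b i)
ind-anyFin zero    b _ = refl
ind-anyFin (suc k) b unique with b zero in b₀
... | true  = sym (trans (cong (1ℚ +_) (∑-zero others-false)) (ℚ.+-identityʳ 1ℚ))
  where
  others-false : ∀ i → ind (b (suc i)) ≡ 0ℚ
  others-false i with b (suc i) in bᵢ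
  ... | true  with () ← unique zero (suc i) b₀ bᵢ
  ... | false = refl
... | false = trans (ind-anyFin k (b ∘ suc) (λ i j p q → suc-injective (unique _ _ p q)))
                    (sym (ℚ.+-identityˡ _))

∑-ind≡countFin : ∀ k (b : Fin k → Bool) → ∑[ i < k ] ind (b i) ≡ countFin k b × 1ℚ
∑-ind≡countFin zero    b = refl
∑-ind≡countFin (suc k) b with b zero
... | true  = cong (1ℚ +_) (∑-ind≡countFin k (b ∘ suc))
... | false = trans (ℚ.+-identityˡ _) (∑-ind≡countFin k (b ∘ suc))

toℚᵘ-/ : ∀ p q → toℚᵘ (ℤ.+ p / suc q) ℚᵘ.≃ mkℚᵘ (ℤ.+ p) q
toℚᵘ-/ p q = ℚ.toℚᵘ-fromℚᵘ (mkℚᵘ (ℤ.+ p) q)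

toℚᵘ-×1 : ∀ k → toℚᵘ (k × 1ℚ) ℚᵘ.≃ mkℚᵘ (ℤ.+ k) 0
toℚᵘ-×1 zero    = *≡* refl
toℚᵘ-×1 (suc k) = ℚᵘ.≃-trans (ℚ.toℚᵘ-homo-+ 1ℚ (k × 1ℚ))
  (ℚᵘ.≃-trans (ℚᵘ.+-congʳ (toℚᵘ 1ℚ) (toℚᵘ-×1 k))
    (*≡* (cong (λ x → (ℤ.+ 1 ℤ.+ x) ℤ.* ℤ.+ 1) (ℤ.*-identityʳ (ℤ.+ k)))))

×1-*-/ : ∀ p q → suc q × 1ℚ * (ℤ.+ p / suc q) ≡ p × 1ℚ
×1-*-/ p q = ℚ.toℚᵘ-injective (ℚᵘ.≃-trans (ℚ.toℚᵘ-homo-* (suc q × 1ℚ) (ℤ.+ p / suc q))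
  (ℚᵘ.≃-trans (ℚᵘ.*-cong (toℚᵘ-×1 (suc q)) (toℚᵘ-/ p q))
    (ℚᵘ.≃-trans (*≡* numerators) (ℚᵘ.≃-sym (toℚᵘ-×1 p)))))
  where
  numerators : (ℤ.+ suc q ℤ.* ℤ.+ p) ℤ.* ℤ.+ 1 ≡ ℤ.+ p ℤ.* ℤ.+ (1 ℕ.* suc q)
  numerators = trans (ℤ.*-identityʳ _) (trans (ℤ.*-comm (ℤ.+ suc q) (ℤ.+ p))
    (cong (λ x → ℤ.+ p ℤ.* ℤ.+ x) (sym (ℕ.*-identityˡ (suc q)))))

rOpt-scaling : ∀ m n a → invℕ (suc m) * (m × 1ℚ * (a × 1ℚ)) ≡
                         suc n × 1ℚ * rOpt (suc m) (suc (suc n)) a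
rOpt-scaling m n a = begin
  u * (m × 1ℚ * (a × 1ℚ))
    ≡⟨ cong (u *_) (trans (ℚ.*-comm (m × 1ℚ) (a × 1ℚ)) (sym (×1-homo-* a m))) ⟩
  u * ((a ℕ.* m) × 1ℚ)
    ≡⟨ cong (u *_) (sym (×1-*-/ (a ℕ.* m) (n ℕ.+ m ℕ.* suc n))) ⟩
  u * ((suc m ℕ.* suc n) × 1ℚ * R)
    ≡⟨ cong (λ x → u * (x * R)) (×1-homo-* (suc m) (suc n)) ⟩
  u * (suc m × 1ℚ * suc n × 1ℚ * R)
    ≡⟨ regroup u (suc m × 1ℚ) (suc n × 1ℚ) R ⟩
  suc m × 1ℚ * u * (suc n × 1ℚ * R)
    ≡⟨ cong (_* (suc n × 1ℚ * R)) (trans (×1-*-/ 1 m) (×-homo-1 1ℚ)) ⟩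
  1ℚ * (suc n × 1ℚ * R)
    ≡⟨ ℚ.*-identityˡ _ ⟩
  suc n × 1ℚ * R
    ∎
  where
  u = invℕ (suc m)
  R = rOpt (suc m) (suc (suc n)) a
  open +-*-Solver
  regroup : ∀ u M N R → u * (M * N * R) ≡ M * u * (N * R)
  regroup = solve 4 (λ u M N R → u :* (M :* N :* R) := M :* u :* (N :* R)) refl

module _ {n} (G : FinAbGroup n) where
  open FinAbGroup G

  finGroup : Group 0ℓ 0ℓ
  finGroup = record { isGroup = IsAbelianGroup.isGroup isAbelianGroup }

  open import Algebra.Properties.Group finGroup using (\\-leftDividesˡ; \\-leftDividesʳ)

  translation : Fin n → Permutation n n
  translation g = permutation (g ⊕_) ((⊖ g) ⊕_) (\\-leftDividesˡ g) (\\-leftDividesʳ g)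

  ∑-translate : ∀ g (f : Fin n → ℚ) → ∑[ Δ < n ] f (g ⊕ Δ) ≡ sum f
  ∑-translate g f = sym (∑-permute f (translation g))

  pointStrategy : (Δ₀ : Fin n) → Δ₀ ≢ 𝟘 → Strategy G
  pointStrategy Δ₀ Δ₀≢𝟘 = record
    { σ        = λ Δ → ind (Δ ≡ᵇ Δ₀)
    ; σ-nonneg = λ Δ → ind-nonneg (Δ ≡ᵇ Δ₀)
    ; σ-zero   = ind-≡ᵇ-≢ (Δ₀≢𝟘 ∘ sym)
    ; σ-sum    = trans (sumFin≡sum n _)
                   (trans (∑-single _ Δ₀ (λ _ → ind-≡ᵇ-≢)) (ind-≡ᵇ-refl Δ₀))
    }

dropFirstSource : ∀ {n m} {G : FinAbGroup n} → AMDCode G (suc m) → AMDCode G m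
dropFirstSource C = record
  { A         = A ∘ suc
  ; disjoint  = λ s t g p q → suc-injective (disjoint (suc s) (suc t) g p q)
  ; nonempty  = nonempty ∘ suc
  ; P         = P ∘ suc
  ; P-nonneg  = P-nonneg ∘ suc
  ; P-support = P-support ∘ suc
  ; P-sum     = P-sum ∘ suc
  }
  where open AMDCode C

module _ {n m} (G : FinAbGroup n) (C : AMDCode G m) where
  open FinAbGroup G
  open AMDCode C
  open IsAbelianGroup isAbelianGroup using (identityʳ)

  encodings : Fin m → ℚ
  encodings t = ∑[ h < n ] ind (A t h)

  ind-wins : ∀ s g Δ → ind (wins G C s g Δ) ≡ ∑[ t < m ] (ind (s ≢ᵇ t) * ind (A t (g ⊕ Δ)))
  ind-wins s g Δ = trans
    (ind-anyFin m _ (λ t t′ p q → disjoint t t′ (g ⊕ Δ) (∧-conicalʳ _ _ p) (∧-conicalʳ _ _ q)))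
    (sum-cong-≗ (λ t → ind-∧ (s ≢ᵇ t) _))

  ∑-wins : ∀ s g → ∑[ Δ < n ] ind (wins G C s g Δ) ≡ ∑[ t < m ] (ind (s ≢ᵇ t) * encodings t)
  ∑-wins s g = begin
    ∑[ Δ < n ] ind (wins G C s g Δ)
      ≡⟨ sum-cong-≗ (ind-wins s g) ⟩
    ∑[ Δ < n ] ∑[ t < m ] (ind (s ≢ᵇ t) * ind (A t (g ⊕ Δ)))
      ≡⟨ ∑-comm (λ Δ t → ind (s ≢ᵇ t) * ind (A t (g ⊕ Δ))) ⟩
    ∑[ t < m ] ∑[ Δ < n ] (ind (s ≢ᵇ t) * ind (A t (g ⊕ Δ)))
      ≡⟨ sum-cong-≗ (λ t → sym (*-distribˡ-sum (ind (s ≢ᵇ t)) (λ Δ → ind (A t (g ⊕ Δ))))) ⟩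
    ∑[ t < m ] (ind (s ≢ᵇ t) * ∑[ Δ < n ] ind (A t (g ⊕ Δ)))
      ≡⟨ sum-cong-≗ (λ t → cong (ind (s ≢ᵇ t) *_) (∑-translate G g (ind ∘ A t))) ⟩
    ∑[ t < m ] (ind (s ≢ᵇ t) * encodings t)
      ∎

  expectedWins : Fin n → ℚ
  expectedWins Δ = ∑[ s < m ] ∑[ g < n ] (P s g * ind (wins G C s g Δ))

  epsΔ≡invℕ*expectedWins : ∀ Δ → epsΔ G C Δ ≡ invℕ m * expectedWins Δ
  epsΔ≡invℕ*expectedWins Δ = cong (invℕ m *_) (trans (sumFin≡sum m _)
    (sum-cong-≗ (λ s → sumFin≡sum n (λ g → P s g * ind (wins G C s g Δ)))))

  ∑-expectedWins : ∑[ Δ < n ] expectedWins Δ ≡ ∑[ s < m ] ∑[ t < m ] (ind (s ≢ᵇ t) * encodings t)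
  ∑-expectedWins = begin
    ∑[ Δ < n ] ∑[ s < m ] ∑[ g < n ] (P s g * win s g Δ)
      ≡⟨ ∑-comm (λ Δ s → ∑[ g < n ] (P s g * win s g Δ)) ⟩
    ∑[ s < m ] ∑[ Δ < n ] ∑[ g < n ] (P s g * win s g Δ)
      ≡⟨ sum-cong-≗ (λ s → ∑-comm (λ Δ g → P s g * win s g Δ)) ⟩
    ∑[ s < m ] ∑[ g < n ] ∑[ Δ < n ] (P s g * win s g Δ)
      ≡⟨ sum-cong-≗ (λ s → sum-cong-≗ (λ g → sym (*-distribˡ-sum (P s g) (win s g)))) ⟩
    ∑[ s < m ] ∑[ g < n ] (P s g * ∑[ Δ < n ] win s g Δ)
      ≡⟨ sum-cong-≗ (λ s → sum-cong-≗ (λ g → cong (P s g *_) (∑-wins s g))) ⟩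
    ∑[ s < m ] ∑[ g < n ] (P s g * K s)
      ≡⟨ sum-cong-≗ (λ s → sym (*-distribʳ-sum (K s) (P s))) ⟩
    ∑[ s < m ] (sum (P s) * K s)
      ≡⟨ sum-cong-≗ (λ s → cong (_* K s) (trans (sym (sumFin≡sum n (P s))) (P-sum s))) ⟩
    ∑[ s < m ] (1ℚ * K s)
      ≡⟨ sum-cong-≗ (λ s → ℚ.*-identityˡ (K s)) ⟩
    ∑[ s < m ] K s
      ∎
    where
    win : Fin m → Fin n → Fin n → ℚ
    win s g Δ = ind (wins G C s g Δ)
    K : Fin m → ℚ
    K s = ∑[ t < m ] (ind (s ≢ᵇ t) * encodings t)

  epsΔ-𝟘 : epsΔ G C 𝟘 ≡ 0ℚ
  epsΔ-𝟘 = begin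
    epsΔ G C 𝟘              ≡⟨ epsΔ≡invℕ*expectedWins 𝟘 ⟩
    invℕ m * expectedWins 𝟘 ≡⟨ cong (invℕ m *_) (∑-zero (∑-zero ∘ no-win)) ⟩
    invℕ m * 0ℚ             ≡⟨ ℚ.*-zeroʳ (invℕ m) ⟩
    0ℚ                      ∎
    where
    no-win : ∀ s g → P s g * ind (wins G C s g 𝟘) ≡ 0ℚ
    no-win s g with A s g in g∈As
    ... | false rewrite P-support s g g∈As = ℚ.*-zeroˡ (ind (wins G C s g 𝟘))
    ... | true  = trans (cong (P s g *_) (trans (ind-wins s g 𝟘) (∑-zero no-other-owner)))
                        (ℚ.*-zeroʳ (P s g))
      where
      no-other-owner : ∀ t → ind (s ≢ᵇ t) * ind (A t (g ⊕ 𝟘)) ≡ 0ℚ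
      no-other-owner t with s ≟ t
      ... | yes _ = ℚ.*-zeroˡ (ind (A t (g ⊕ 𝟘)))
      ... | no s≢t rewrite identityʳ g with A t g in g∈At
      ...   | true  = contradiction (disjoint s t g g∈As g∈At) s≢t
      ...   | false = ℚ.*-zeroʳ 1ℚ

  epsσ-pointStrategy : ∀ Δ₀ (Δ₀≢𝟘 : Δ₀ ≢ 𝟘) → epsσ G C (pointStrategy G Δ₀ Δ₀≢𝟘) ≡ epsΔ G C Δ₀
  epsσ-pointStrategy Δ₀ _ = trans (sumFin≡sum n _) (∑-δ (epsΔ G C) Δ₀)

  epsσ-constant : ∀ {c} → (∀ Δ → Δ ≢ 𝟘 → epsΔ G C Δ ≡ c) → ∀ S → epsσ G C S ≡ c
  epsσ-constant {c} ε≡c S = begin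
    sumFin n (λ Δ → σ Δ * epsΔ G C Δ) ≡⟨ sumFin≡sum n _ ⟩
    ∑[ Δ < n ] (σ Δ * epsΔ G C Δ)     ≡⟨ sum-cong-≗ σε≡σc ⟩
    ∑[ Δ < n ] (σ Δ * c)              ≡⟨ sym (*-distribʳ-sum c σ) ⟩
    sum σ * c                         ≡⟨ cong (_* c) (trans (sym (sumFin≡sum n σ)) σ-sum) ⟩
    1ℚ * c                            ≡⟨ ℚ.*-identityˡ c ⟩
    c                                 ∎
    where
    open Strategy S
    σε≡σc : ∀ Δ → σ Δ * epsΔ G C Δ ≡ σ Δ * c
    σε≡σc Δ with Δ ≟ 𝟘
    ... | yes refl rewrite σ-zero = trans (ℚ.*-zeroˡ (epsΔ G C 𝟘)) (sym (ℚ.*-zeroˡ c))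
    ... | no Δ≢𝟘   = cong (σ Δ *_) (ε≡c Δ Δ≢𝟘)

∑-encodings : ∀ {n m} {G : FinAbGroup n} (C : AMDCode G m) → sum (encodings G C) ≡ totalEnc C × 1ℚ
∑-encodings {m = zero}  C = refl
∑-encodings {n} {suc m} C = trans
  (cong₂ _+_ (∑-ind≡countFin n (AMDCode.A C zero)) (∑-encodings (dropFirstSource C)))
  (sym (×-homo-+ 1ℚ (countFin n (AMDCode.A C zero)) (totalEnc (dropFirstSource C))))

∑-epsΔ : ∀ {n m} (G : FinAbGroup n) (C : AMDCode G (suc m)) →
         ∑[ Δ < n ] epsΔ G C Δ ≡ invℕ (suc m) * (m × 1ℚ * (totalEnc C × 1ℚ))
∑-epsΔ {n} {m} G C = begin
  ∑[ Δ < n ] epsΔ G C Δ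
    ≡⟨ sum-cong-≗ (epsΔ≡invℕ*expectedWins G C) ⟩
  ∑[ Δ < n ] (invℕ (suc m) * expectedWins G C Δ)
    ≡⟨ sym (*-distribˡ-sum (invℕ (suc m)) (expectedWins G C)) ⟩
  invℕ (suc m) * sum (expectedWins G C)
    ≡⟨ cong (invℕ (suc m) *_) (∑-expectedWins G C) ⟩
  invℕ (suc m) * ∑[ s < suc m ] ∑[ t < suc m ] (ind (s ≢ᵇ t) * encodings G C t)
    ≡⟨ cong (invℕ (suc m) *_) (∑-off-diagonal (encodings G C)) ⟩
  invℕ (suc m) * (m × 1ℚ * sum (encodings G C))
    ≡⟨ cong (λ x → invℕ (suc m) * (m × 1ℚ * x)) (∑-encodings C) ⟩
  invℕ (suc m) * (m × 1ℚ * (totalEnc C × 1ℚ))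
    ∎

constant⇒EpsHatIs : ∀ {n m} (G : FinAbGroup n) (C : AMDCode G m) {c} → 2 ≤ n →
                    (∀ Δ → Δ ≢ FinAbGroup.𝟘 G → epsΔ G C Δ ≡ c) → EpsHatIs G C c
constant⇒EpsHatIs G C (s≤s (s≤s z≤n)) ε≡c =
  (λ S → ℚ.≤-reflexive (epsσ-constant G C ε≡c S)) ,
  (pointStrategy G Δ₀ Δ₀≢𝟘 , trans (epsσ-pointStrategy G C Δ₀ Δ₀≢𝟘) (ε≡c Δ₀ Δ₀≢𝟘))
  where
  Δ₀ = punchIn (FinAbGroup.𝟘 G) zero
  Δ₀≢𝟘 = punchInᵢ≢i (FinAbGroup.𝟘 G) zero

EpsHatIs⇒constant : ∀ {n m} (G : FinAbGroup (suc n)) (C : AMDCode G m) {c} →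
                    ∑[ Δ < suc n ] epsΔ G C Δ ≡ n × 1ℚ * c → EpsHatIs G C c →
                    ∀ Δ → Δ ≢ FinAbGroup.𝟘 G → epsΔ G C Δ ≡ c
EpsHatIs⇒constant {n} G C {c} ∑ε (ε≤c , _) Δ Δ≢𝟘 = begin
  epsΔ G C Δ       ≡⟨ ∑-≤-≡⇒≡ ε≤bound (trans ∑ε (sym ∑bound)) Δ ⟩
  ind (Δ ≢ᵇ 𝟘) * c ≡⟨ cong (_* c) (ind-≢ᵇ-≢ Δ≢𝟘) ⟩
  1ℚ * c           ≡⟨ ℚ.*-identityˡ c ⟩
  c                ∎
  where
  open FinAbGroup G using (𝟘)
  bound : Fin (suc n) → ℚ
  bound Δ = ind (Δ ≢ᵇ 𝟘) * c

  ∑bound : sum bound ≡ n × 1ℚ * c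
  ∑bound = trans (sym (*-distribʳ-sum c (λ Δ → ind (Δ ≢ᵇ 𝟘)))) (cong (_* c) (∑-≢ᵇ 𝟘))

  ε≤bound : ∀ Δ → epsΔ G C Δ ℚ.≤ bound Δ
  ε≤bound Δ with Δ ≟ 𝟘
  ... | yes refl = ℚ.≤-reflexive (trans (epsΔ-𝟘 G C) (sym (ℚ.*-zeroˡ c)))
  ... | no Δ≢𝟘   = subst₂ ℚ._≤_ (epsσ-pointStrategy G C Δ Δ≢𝟘) (sym (ℚ.*-identityˡ c))
                   (ε≤c (pointStrategy G Δ Δ≢𝟘))

mainTheorem7 : ∀ {n m : ℕ} (G : FinAbGroup n) → 2 ≤ n → 1 ≤ m → (C : AMDCode G m) →
    EpsHatIs G C (rOpt m n (totalEnc C))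
      ⇔ (∀ (Δ : Fin n) → Δ ≢ FinAbGroup.𝟘 G → epsΔ G C Δ ≡ rOpt m n (totalEnc C))
mainTheorem7 {suc (suc n)} {suc m} G 2≤n@(s≤s (s≤s z≤n)) (s≤s z≤n) C =
  mk⇔ (EpsHatIs⇒constant G C ∑ε) (constant⇒EpsHatIs G C 2≤n)
  where
  ∑ε : ∑[ Δ < suc (suc n) ] epsΔ G C Δ ≡ suc n × 1ℚ * rOpt (suc m) (suc (suc n)) (totalEnc C)
  ∑ε = trans (∑-epsΔ G C) (rOpt-scaling m n (totalEnc C))
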